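{- Let $m$ and $n$ be positive integers, and let $\lambda=[\lambda_1,\ldots,\lambda_n]$ be a partition with exactly $n$ parts and $\lambda_1=n$. Then $m\odot\lambda$ has exactly $mn$ parts with first part $mn$, and \[ \#\operatorname{RP}(m \odot \lambda) = (m!)^n \cdot \prod_{i=1}^n \binom{m(\lambda_i - (n-i))}{m}, \] where for $a\in\mathbb{Z}$ and $b\in\mathbb{Z}_{\ge1}$, $\binom{a}{b} := \frac{a(a-1)\cdots(a-b+1)}{b!}$.
   Context: A partition is a finite weakly decreasing sequence of positive integers. For a partition $\lambda$ and a positive integer $m$, $m\odot\lambda$ is the partition whose Young diagram is obtained from that of $\lambda$ by replacing each box by an $m\times m$ array of boxes (equivalently, each part $\lambda_i$ is replaced by $m$ copies of $m\lambda_i$). For a partition $\lambda$ with exactly $n$ parts and $\lambda_1=n$, $\operatorname{RP}(\lambda)$ is the set of $n\times n$ permutation matrices $\pi=(\pi_{ij})$ such that $\pi_{ij}=0$ whenever $j>\lambda_{n+1-i}$. -}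

module Defs where

open import Data.Nat as ℕ using (ℕ; zero; suc; _≥_; _≤_; _<_; _!; _≡ᵇ_; _<ᵇ_; _∸_)
open import Data.Nat.Properties using (_!≢0)
open import Data.Integer as ℤ using (ℤ; +_)
open import Data.Bool using (Bool; true; false; _∧_; _∨_; not)
open import Data.List as List using (List; []; _∷_; length; replicate; concatMap; filterᵇ; allFin)

open import Data.List.Relation.Unary.All using (All)
open import Data.List.Relation.Unary.Linked using (Linked)
open import Data.Product using (_×_)
open import Data.Vec as Vec using (Vec; []; _∷_)
open import Data.Fin as Fin using (Fin; toℕ)

all : ∀ {A : Set} → (A → Bool) → List A → Bool
all p []       = true
all p (x ∷ xs) = p x ∧ all p xs

IsPartition : List ℕ → Set
IsPartition ls = All (λ x → 1 ≤ x) ls × Linked _≥_ ls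

_⊙_ : ℕ → List ℕ → List ℕ
m ⊙ ls = concatMap (λ x → replicate m (m ℕ.* x)) ls

-- 1-indexed part λ_k (returns 0 when k = 0 or k > length)
part : List ℕ → ℕ → ℕ
part []       _             = 0
part (x ∷ xs) zero          = 0
part (x ∷ xs) (suc zero)    = x
part (x ∷ xs) (suc (suc k)) = part xs (suc k)

-- n×n 0/1 matrices, as vectors of rows of Booleans (true = 1, false = 0)

Matrix : ℕ → Set
Matrix n = Vec (Vec Bool n) n

allVecs : (k : ℕ) → List (Vec Bool k)
allVecs zero    = [] ∷ []
allVecs (suc k) = concatMap (λ v → (false ∷ v) ∷ (true ∷ v) ∷ []) (allVecs k)

allRows : (r c : ℕ) → List (Vec (Vec Bool c) r)
allRows zero    c = [] ∷ []
allRows (suc r) c =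
  concatMap (λ M → List.map (λ row → row ∷ M) (allVecs c)) (allRows r c)

-- every n×n 0/1 matrix, each exactly once
allMatrices : (n : ℕ) → List (Matrix n)
allMatrices n = allRows n n

countTrue : ∀ {k} → Vec Bool k → ℕ
countTrue []          = 0
countTrue (true ∷ v)  = suc (countTrue v)
countTrue (false ∷ v) = countTrue v

-- π_{ij}, with 0-indexed i (row) and j (column)
entry : ∀ {n} → Matrix n → Fin n → Fin n → Bool
entry M i j = Vec.lookup (Vec.lookup M i) j

column : ∀ {n} → Matrix n → Fin n → Vec Bool n
column M j = Vec.map (λ row → Vec.lookup row j) M

isPermMatrix : ∀ {n} → Matrix n → Bool
isPermMatrix {n} M =
  all (λ i → countTrue (Vec.lookup M i) ≡ᵇ 1) (allFin n) ∧
  all (λ j → countTrue (column M j) ≡ᵇ 1) (allFin n)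

-- shape condition for RP(λ), n = length λ:  π_{ij} = 0 whenever j > λ_{n+1-i}
-- (1-indexed i, j).  With 0-indexed r = i-1, c = j-1 this reads:
-- π true at (r,c) implies c+1 ≤ λ_{n-r}.
fitsRP : (ls : List ℕ) → Matrix (length ls) → Bool
fitsRP ls M =
  all (λ r → all (λ c → not (entry M r c) ∨ (toℕ c <ᵇ part ls (length ls ∸ toℕ r)))
                 (allFin (length ls)))
      (allFin (length ls))

RP : (ls : List ℕ) → List (Matrix (length ls))
RP ls = filterᵇ (λ M → isPermMatrix M ∧ fitsRP ls M) (allMatrices (length ls))

#RP : List ℕ → ℕ
#RP ls = length (RP ls)

-- Generalised binomial coefficient  (a choose b) = a(a-1)…(a-b+1)/b!
-- for a ∈ ℤ, b ∈ ℕ (the division is exact)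

fallingℤ : ℤ → ℕ → ℤ
fallingℤ a zero    = + 1
fallingℤ a (suc b) = a ℤ.* fallingℤ (a ℤ.- + 1) b

binomℤ : ℤ → ℕ → ℤ
binomℤ a b = ℤ._/ℕ_ (fallingℤ a b) (b !) {{b !≢0}}

prodℤ : ℕ → (ℕ → ℤ) → ℤ
prodℤ zero    f = + 1
prodℤ (suc n) f = prodℤ n f ℤ.* f (suc n)

module Submission where

-- Read a matrix of RP(μ) from the top row down: row r may only use the first μ_{N−r} columns, and
-- these bounds increase, so the columns taken by the rows above all lie inside the current bound.
-- Hence row r has exactly μ_{N−r} − r free columns and #RP(μ) = ∏ᵢ (μᵢ − (N − i)), truncated at 0.
-- For μ = m ⊙ λ the m equal parts m·λᵢ contribute the falling factorial of m(λᵢ − (n − i)) of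
-- length m, which is m! times the binomial coefficient. If some λᵢ < n − i, the sequence
-- λᵢ − (n − i) passes through 0 on its way down, so both sides vanish.

open import Defs
open import Data.Bool using (Bool; true; false; T; _∧_; _∨_; not)
open import Data.Bool.Properties using (T-∧; T-≡)
open import Data.Empty using (⊥; ⊥-elim)
open import Data.Fin using (Fin; toℕ) renaming (zero to fzero; suc to fsuc)
open import Data.Fin.Properties using (toℕ<n)
open import Data.List as List using (List; []; _∷_; _++_; concatMap; length; head; filterᵇ; allFin)
import Data.List.Properties as List
import Data.List.Relation.Unary.All as ListAll
import Data.List.Relation.Unary.All.Properties as ListAll
open import Data.List.Relation.Unary.Linked as Linked using (Linked; []; [-]; _∷_)
open import Data.Maybe using (just)
open import Data.Maybe.Properties using (just-injective)
open import Data.Nat using (ℕ; zero; suc; _+_; _*_; _∸_; _≤_; _<_; _≥_; z≤n; s≤s; _≡ᵇ_; _<ᵇ_; _!)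
open import Data.Nat.Properties
open import Data.Nat.Combinatorics.Base using (_P′_)
open import Data.Nat.Combinatorics.Specification using (k!∣nP′k; nP′k≡n[n∸1P′k∸1])
open import Data.Nat.Divisibility using (_∣_; _∣0)
open import Data.Nat.DivMod using (_/_; 0/n≡0; m*[n/m]≡n)
open import Data.Nat.Tactic.RingSolver using (solve-∀)
open import Data.Product using (_×_; _,_; proj₁; proj₂)
open import Data.Sum using (_⊎_; inj₁; inj₂)
open import Data.Unit using (⊤; tt)
open import Data.Vec as Vec using (Vec; []; _∷_; _∷ʳ_; lookup; replicate; zipWith)
open import Data.Vec.Properties using (lookup-zipWith; lookup-replicate)
open import Data.Vec.Relation.Unary.All using (All; []; _∷_)
open import Function using (_∘_; _⇔_; mk⇔; Equivalence)
open import Relation.Binary.PropositionalEquality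
open import Relation.Nullary using (¬_; yes; no)

open Equivalence

private variable
  A B : Set
  r c : ℕ

𝟙 : Bool → ℕ
𝟙 true  = 1
𝟙 false = 0

𝟙-∧ : ∀ a b → 𝟙 (a ∧ b) ≡ 𝟙 a * 𝟙 b
𝟙-∧ true  b = sym (+-identityʳ (𝟙 b))
𝟙-∧ false b = refl

T-injective : ∀ {a b} → T a ⇔ T b → a ≡ b
T-injective {false} {false} _ = refl
T-injective {false} {true}  e = ⊥-elim (from e tt)
T-injective {true}  {false} e = ⊥-elim (to e tt)
T-injective {true}  {true}  _ = refl

all-tabulate⇔ : ∀ {n} (p : A → Bool) (f : Fin n → A) →
                T (all p (List.tabulate f)) ⇔ (∀ i → T (p (f i)))
all-tabulate⇔ {n = zero}  p f = mk⇔ (λ _ ()) (λ _ → tt)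
all-tabulate⇔ {n = suc n} p f = mk⇔
  (λ h → let (h₀ , hs) = to T-∧ h in
    λ { fzero → h₀ ; (fsuc i) → to (all-tabulate⇔ p (f ∘ fsuc)) hs i })
  (λ h → from T-∧ (h fzero , from (all-tabulate⇔ p (f ∘ fsuc)) (h ∘ fsuc)))

all-allFin⇔ : ∀ {n} (p : Fin n → Bool) → T (all p (allFin n)) ⇔ (∀ i → T (p i))
all-allFin⇔ p = all-tabulate⇔ p (λ i → i)

not∨⇔ : ∀ a b → T (not a ∨ b) ⇔ (T a → T b)
not∨⇔ true  b = mk⇔ (λ b′ _ → b′) (λ f → f tt)
not∨⇔ false b = mk⇔ (λ _ ()) (λ _ → tt)

sumBy : (A → ℕ) → List A → ℕ
sumBy f []       = 0
sumBy f (x ∷ xs) = f x + sumBy f xs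

length-filterᵇ : (p : A → Bool) (xs : List A) → length (filterᵇ p xs) ≡ sumBy (𝟙 ∘ p) xs
length-filterᵇ p []       = refl
length-filterᵇ p (x ∷ xs) with p x
... | true  = cong suc (length-filterᵇ p xs)
... | false = length-filterᵇ p xs

sumBy-cong : {f g : A → ℕ} → (∀ x → f x ≡ g x) → ∀ xs → sumBy f xs ≡ sumBy g xs
sumBy-cong f≗g []       = refl
sumBy-cong f≗g (x ∷ xs) = cong₂ _+_ (f≗g x) (sumBy-cong f≗g xs)

sumBy-zero : {f : A → ℕ} → (∀ x → f x ≡ 0) → ∀ xs → sumBy f xs ≡ 0
sumBy-zero f≗0 []       = refl
sumBy-zero f≗0 (x ∷ xs) rewrite f≗0 x = sumBy-zero f≗0 xs

sumBy-++ : (f : A → ℕ) (xs ys : List A) → sumBy f (xs ++ ys) ≡ sumBy f xs + sumBy f ys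
sumBy-++ f []       ys = refl
sumBy-++ f (x ∷ xs) ys rewrite sumBy-++ f xs ys = sym (+-assoc (f x) _ _)

sumBy-concatMap : (f : B → ℕ) (g : A → List B) (xs : List A) →
                  sumBy f (concatMap g xs) ≡ sumBy (sumBy f ∘ g) xs
sumBy-concatMap f g []       = refl
sumBy-concatMap f g (x ∷ xs) rewrite sumBy-++ f (g x) (concatMap g xs) =
  cong (sumBy f (g x) +_) (sumBy-concatMap f g xs)

sumBy-map : (f : B → ℕ) (g : A → B) (xs : List A) → sumBy f (List.map g xs) ≡ sumBy (f ∘ g) xs
sumBy-map f g []       = refl
sumBy-map f g (x ∷ xs) = cong (f (g x) +_) (sumBy-map f g xs)

sumBy-+ : (f g : A → ℕ) (xs : List A) → sumBy (λ x → f x + g x) xs ≡ sumBy f xs + sumBy g xs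
sumBy-+ f g []       = refl
sumBy-+ f g (x ∷ xs) rewrite sumBy-+ f g xs = interchange (f x) (g x) (sumBy f xs) (sumBy g xs)
  where
  interchange : ∀ a b c d → a + b + (c + d) ≡ a + c + (b + d)
  interchange = solve-∀

sumBy-*ˡ : (k : ℕ) (f : A → ℕ) (xs : List A) → sumBy (λ x → k * f x) xs ≡ k * sumBy f xs
sumBy-*ˡ k f []       = sym (*-zeroʳ k)
sumBy-*ˡ k f (x ∷ xs) rewrite sumBy-*ˡ k f xs = sym (*-distribˡ-+ k (f x) _)

sumBy-comm : (h : A → B → ℕ) (xs : List A) (ys : List B) →
             sumBy (λ x → sumBy (h x) ys) xs ≡ sumBy (λ y → sumBy (λ x → h x y) xs) ys
sumBy-comm h []       ys = sym (sumBy-zero (λ _ → refl) ys)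
sumBy-comm h (x ∷ xs) ys rewrite sumBy-comm h xs ys = sym (sumBy-+ (h x) _ ys)

sumBy-allVecs : (f : Vec Bool (suc c) → ℕ) →
                sumBy f (allVecs (suc c)) ≡ sumBy (λ v → f (false ∷ v) + f (true ∷ v)) (allVecs c)
sumBy-allVecs {c} f =
  trans (sumBy-concatMap f _ (allVecs c))
        (sumBy-cong (λ v → cong (f (false ∷ v) +_) (+-identityʳ _)) (allVecs c))

sumBy-allRows : (f : Vec (Vec Bool c) (suc r) → ℕ) →
                sumBy f (allRows (suc r) c)
                  ≡ sumBy (λ v → sumBy (λ M → f (v ∷ M)) (allRows r c)) (allVecs c)
sumBy-allRows {c} {r} f = begin
  sumBy f (allRows (suc r) c)
    ≡⟨ sumBy-concatMap f _ (allRows r c) ⟩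
  sumBy (λ M → sumBy f (List.map (_∷ M) (allVecs c))) (allRows r c)
    ≡⟨ sumBy-cong (λ M → sumBy-map f (_∷ M) (allVecs c)) (allRows r c) ⟩
  sumBy (λ M → sumBy (λ v → f (v ∷ M)) (allVecs c)) (allRows r c)
    ≡⟨ sumBy-comm (λ M v → f (v ∷ M)) (allRows r c) (allVecs c) ⟩
  sumBy (λ v → sumBy (λ M → f (v ∷ M)) (allRows r c)) (allVecs c) ∎
  where open ≡-Reasoning

prefix : ℕ → Vec Bool c
prefix {zero}  b       = []
prefix {suc c} zero    = false ∷ prefix zero
prefix {suc c} (suc b) = true ∷ prefix b

vacant : Vec ℕ c → Vec Bool c
vacant = Vec.map (_≡ᵇ 0)

_∩_ : Vec Bool c → Vec Bool c → Vec Bool c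
_∩_ = zipWith _∧_

addRow : Vec ℕ c → Vec Bool c → Vec ℕ c
addRow = zipWith (λ x b → 𝟙 b + x)

unitIn : Vec Bool c → Vec Bool c → Bool
unitIn []      []          = false
unitIn (m ∷ M) (false ∷ v) = unitIn M v
unitIn (m ∷ M) (true  ∷ v) = m ∧ (countTrue v ≡ᵇ 0)

countTrue-∷ : ∀ b (v : Vec Bool c) → countTrue (b ∷ v) ≡ 𝟙 b + countTrue v
countTrue-∷ true  v = refl
countTrue-∷ false v = refl

countTrue≡0⇒¬lookup : (v : Vec Bool c) → countTrue v ≡ 0 → ∀ i → ¬ T (lookup v i)
countTrue≡0⇒¬lookup (false ∷ v) none (fsuc i) = countTrue≡0⇒¬lookup v none i

unitIn⇔ : (M v : Vec Bool c) →
          T (unitIn M v) ⇔ (countTrue v ≡ 1 × (∀ i → T (lookup v i) → T (lookup M i)))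
unitIn⇔ []      []          = mk⇔ (λ ()) (λ ())
unitIn⇔ (m ∷ M) (false ∷ v) = mk⇔
  (λ u → let (one , inM) = to (unitIn⇔ M v) u in one , λ { (fsuc i) → inM i })
  (λ (one , inM) → from (unitIn⇔ M v) (one , inM ∘ fsuc))
unitIn⇔ (m ∷ M) (true  ∷ v) = mk⇔
  (λ u → let (m′ , none) = to T-∧ u; none′ = ≡ᵇ⇒≡ (countTrue v) 0 none in
    cong suc none′ , λ { fzero _ → m′ ; (fsuc i) vᵢ → ⊥-elim (countTrue≡0⇒¬lookup v none′ i vᵢ) })
  (λ (one , inM) → from T-∧ (inM fzero tt , ≡⇒≡ᵇ (countTrue v) 0 (suc-injective one)))

unitIn-∩ˡ : (M N v : Vec Bool c) → T (unitIn (M ∩ N) v) → T (unitIn M v)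
unitIn-∩ˡ []      []      []          ()
unitIn-∩ˡ (m ∷ M) (n ∷ N) (false ∷ v) u = unitIn-∩ˡ M N v u
unitIn-∩ˡ (true ∷ M) (n ∷ N) (true ∷ v) u = proj₂ (to T-∧ u)

unitIn-prefix-zero : (v : Vec Bool c) → ¬ T (unitIn (prefix zero) v)
unitIn-prefix-zero (false ∷ v) u = unitIn-prefix-zero v u

prefix⇔ : ∀ b (i : Fin c) → T (lookup (prefix b) i) ⇔ toℕ i < b
prefix⇔ zero    fzero    = mk⇔ (λ ()) (λ ())
prefix⇔ zero    (fsuc i) = mk⇔ (⊥-elim ∘ n≮0 ∘ to (prefix⇔ zero i)) (λ ())
prefix⇔ (suc b) fzero    = mk⇔ (λ _ → s≤s z≤n) (λ _ → tt)
prefix⇔ (suc b) (fsuc i) = mk⇔ (s≤s ∘ to (prefix⇔ b i)) (λ { (s≤s i<b) → from (prefix⇔ b i) i<b })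

#zeroVecs : ∀ c → sumBy (λ v → 𝟙 (countTrue v ≡ᵇ 0)) (allVecs c) ≡ 1
#zeroVecs zero    = refl
#zeroVecs (suc c) =
  trans (sumBy-allVecs {c} _) (trans (sumBy-cong (λ v → +-identityʳ _) (allVecs c)) (#zeroVecs c))

#unitIn : (M : Vec Bool c) → sumBy (𝟙 ∘ unitIn M) (allVecs c) ≡ countTrue M
#unitIn []                = refl
#unitIn {suc c} (m ∷ M) = begin
  sumBy (𝟙 ∘ unitIn (m ∷ M)) (allVecs (suc c))
    ≡⟨ sumBy-allVecs (𝟙 ∘ unitIn (m ∷ M)) ⟩
  sumBy (λ v → 𝟙 (unitIn M v) + 𝟙 (m ∧ (countTrue v ≡ᵇ 0))) (allVecs c)
    ≡⟨ sumBy-+ (𝟙 ∘ unitIn M) _ (allVecs c) ⟩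
  sumBy (𝟙 ∘ unitIn M) (allVecs c) + sumBy (λ v → 𝟙 (m ∧ (countTrue v ≡ᵇ 0))) (allVecs c)
    ≡⟨ cong₂ _+_ (#unitIn M) (#first m) ⟩
  countTrue M + 𝟙 m
    ≡⟨ +-comm (countTrue M) (𝟙 m) ⟩
  𝟙 m + countTrue M
    ≡⟨ countTrue-∷ m M ⟨
  countTrue (m ∷ M) ∎
  where
  open ≡-Reasoning
  #first : ∀ m → sumBy (λ v → 𝟙 (m ∧ (countTrue v ≡ᵇ 0))) (allVecs c) ≡ 𝟙 m
  #first true  = #zeroVecs c
  #first false = sumBy-zero (λ _ → refl) (allVecs c)

sum-addRow : (C : Vec ℕ c) (v : Vec Bool c) → Vec.sum (addRow C v) ≡ Vec.sum C + countTrue v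
sum-addRow []      []          = refl
sum-addRow (x ∷ C) (false ∷ v) rewrite sum-addRow C v = sym (+-assoc x _ _)
sum-addRow (x ∷ C) (true  ∷ v) rewrite sum-addRow C v = trans (cong suc (sym (+-assoc x _ _))) (sym (+-suc _ _))

sum-addRow-unitIn : (M : Vec Bool c) (C : Vec ℕ c) (v : Vec Bool c) →
                    T (unitIn M v) → Vec.sum (addRow C v) ≡ suc (Vec.sum C)
sum-addRow-unitIn M C v u =
  trans (sum-addRow C v) (trans (cong (Vec.sum C +_) (proj₁ (to (unitIn⇔ M v) u))) (+-comm _ 1))

addRow-zeros : (C : Vec ℕ c) (v : Vec Bool c) → countTrue v ≡ 0 → addRow C v ≡ C
addRow-zeros []      []          _    = refl
addRow-zeros (x ∷ C) (false ∷ v) none = cong (x ∷_) (addRow-zeros C v none)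

Binary : Vec ℕ c → Set
Binary = All (_≤ 1)

allOnes : Vec ℕ c → Bool
allOnes []      = true
allOnes (x ∷ C) = (x ≡ᵇ 1) ∧ allOnes C

allOnes⇒binary : (C : Vec ℕ c) → T (allOnes C) → Binary C
allOnes⇒binary []      _    = []
allOnes⇒binary (x ∷ C) ones =
  let (x≡1 , rest) = to T-∧ ones in ≤-reflexive (≡ᵇ⇒≡ x 1 x≡1) ∷ allOnes⇒binary C rest

binary-addRow⁻ : (C : Vec ℕ c) (v : Vec Bool c) → Binary (addRow C v) → Binary C
binary-addRow⁻ []      []          []             = []
binary-addRow⁻ (x ∷ C) (false ∷ v) (x≤1 ∷ bin)    = x≤1 ∷ binary-addRow⁻ C v bin
binary-addRow⁻ (x ∷ C) (true  ∷ v) (s≤s x≤0 ∷ bin) = m≤n⇒m≤1+n x≤0 ∷ binary-addRow⁻ C v bin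

binary-addRow⇔ : (M : Vec Bool c) (C : Vec ℕ c) (v : Vec Bool c) → Binary C → T (unitIn M v) →
                 Binary (addRow C v) ⇔ T (unitIn (M ∩ vacant C) v)
binary-addRow⇔ []      []      []          []          ()
binary-addRow⇔ (m ∷ M) (x ∷ C) (false ∷ v) (x≤1 ∷ bin) u = mk⇔
  (λ { (_ ∷ bin′) → to (binary-addRow⇔ M C v bin u) bin′ })
  (λ w → x≤1 ∷ from (binary-addRow⇔ M C v bin u) w)
binary-addRow⇔ (true ∷ M) (zero ∷ C) (true ∷ v) (_ ∷ bin) u = mk⇔
  (λ _ → u)
  (λ _ → ≤-refl ∷ subst Binary (sym (addRow-zeros C v (≡ᵇ⇒≡ (countTrue v) 0 u))) bin)
binary-addRow⇔ (true ∷ M) (suc x ∷ C) (true ∷ v) _ u = mk⇔ (λ { (s≤s () ∷ _) }) (λ ())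

binary-sum≤length : (C : Vec ℕ c) → Binary C → Vec.sum C ≤ c
binary-sum≤length []      []              = z≤n
binary-sum≤length (_ ∷ C) (z≤n ∷ bin)     = m≤n⇒m≤1+n (binary-sum≤length C bin)
binary-sum≤length (_ ∷ C) (s≤s z≤n ∷ bin) = s≤s (binary-sum≤length C bin)

binary-full⇒allOnes : (C : Vec ℕ c) → Binary C → Vec.sum C ≡ c → T (allOnes C)
binary-full⇒allOnes []      []              _    = tt
binary-full⇒allOnes (_ ∷ C) (z≤n ∷ bin)     full = ⊥-elim (<-irrefl full (s≤s (binary-sum≤length C bin)))
binary-full⇒allOnes (_ ∷ C) (s≤s z≤n ∷ bin) full = binary-full⇒allOnes C bin (suc-injective full)

VanishesFrom : ℕ → Vec ℕ c → Set
VanishesFrom zero    C       = Vec.sum C ≡ 0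
VanishesFrom (suc b) []      = ⊤
VanishesFrom (suc b) (x ∷ C) = VanishesFrom b C

sum≡0⇒vanishesFrom : ∀ b (C : Vec ℕ c) → Vec.sum C ≡ 0 → VanishesFrom b C
sum≡0⇒vanishesFrom zero    C       none = none
sum≡0⇒vanishesFrom (suc b) []      _    = tt
sum≡0⇒vanishesFrom (suc b) (x ∷ C) none = sum≡0⇒vanishesFrom b C (m+n≡0⇒n≡0 x none)

vanishesFrom-mono : ∀ {b b′} (C : Vec ℕ c) → b ≤ b′ → VanishesFrom b C → VanishesFrom b′ C
vanishesFrom-mono {b = zero}  {b′}     C       _           van = sum≡0⇒vanishesFrom b′ C van
vanishesFrom-mono {b = suc b} {suc b′} []      _           _   = tt
vanishesFrom-mono {b = suc b} {suc b′} (x ∷ C) (s≤s b≤b′) van = vanishesFrom-mono C b≤b′ van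

vanishesFrom-addRow : ∀ b (C : Vec ℕ c) (v : Vec Bool c) →
                      VanishesFrom b C → T (unitIn (prefix b) v) → VanishesFrom b (addRow C v)
vanishesFrom-addRow zero    C       v           _   u = ⊥-elim (unitIn-prefix-zero v u)
vanishesFrom-addRow (suc b) []      []          _   _ = tt
vanishesFrom-addRow (suc b) (x ∷ C) (false ∷ v) van u = vanishesFrom-addRow b C v van u
vanishesFrom-addRow (suc b) (x ∷ C) (true  ∷ v) van u =
  subst (VanishesFrom b) (sym (addRow-zeros C v (≡ᵇ⇒≡ (countTrue v) 0 u))) van

sum≤ : ∀ b (C : Vec ℕ c) → VanishesFrom b C → Binary C → Vec.sum C ≤ b
sum≤ zero    C       van _                 = ≤-reflexive van
sum≤ (suc b) []      _   _                 = z≤n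
sum≤ (suc b) (_ ∷ C) van (z≤n ∷ bin)     = m≤n⇒m≤1+n (sum≤ b C van bin)
sum≤ (suc b) (_ ∷ C) van (s≤s z≤n ∷ bin) = s≤s (sum≤ b C van bin)

countTrue-prefix-zero∩ : (N : Vec Bool c) → countTrue (prefix zero ∩ N) ≡ 0
countTrue-prefix-zero∩ []      = refl
countTrue-prefix-zero∩ (n ∷ N) = countTrue-prefix-zero∩ N

countTrue-prefix∩vacant : ∀ b (C : Vec ℕ c) → VanishesFrom b C → Binary C → b ≤ c →
                          countTrue (prefix b ∩ vacant C) ≡ b ∸ Vec.sum C
countTrue-prefix∩vacant zero    C       _   _                 _         =
  trans (countTrue-prefix-zero∩ (vacant C)) (sym (0∸n≡0 (Vec.sum C)))
countTrue-prefix∩vacant (suc b) (_ ∷ C) van (z≤n ∷ bin)     (s≤s b≤c) =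
  trans (cong suc (countTrue-prefix∩vacant b C van bin b≤c)) (sym (+-∸-assoc 1 (sum≤ b C van bin)))
countTrue-prefix∩vacant (suc b) (_ ∷ C) van (s≤s z≤n ∷ bin) (s≤s b≤c) =
  countTrue-prefix∩vacant b C van bin b≤c

-- Rook placements under row bounds

-- C holds the column totals of the rows already placed.
placement : Vec ℕ r → Vec ℕ c → Vec (Vec Bool c) r → Bool
placement []       C []      = allOnes C
placement (b ∷ bs) C (v ∷ M) = unitIn (prefix b) v ∧ placement bs (addRow C v) M

#placements : Vec ℕ r → Vec ℕ c → ℕ
#placements {r} {c} bs C = sumBy (𝟙 ∘ placement bs C) (allRows r c)

freeChoices : Vec ℕ r → ℕ → ℕ
freeChoices []       s = 1
freeChoices (b ∷ bs) s = (b ∸ s) * freeChoices bs (suc s)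

Monotone : Vec ℕ r → Set
Monotone {r} bs = (i j : Fin r) → toℕ i ≤ toℕ j → lookup bs i ≤ lookup bs j

#placements-∷ : ∀ b (bs : Vec ℕ r) (C : Vec ℕ c) →
  #placements (b ∷ bs) C ≡ sumBy (λ v → 𝟙 (unitIn (prefix b) v) * #placements bs (addRow C v)) (allVecs c)
#placements-∷ {r} {c} b bs C =
  trans (sumBy-allRows (𝟙 ∘ placement (b ∷ bs) C))
        (sumBy-cong (λ v → trans (sumBy-cong (λ M → 𝟙-∧ (unitIn (prefix b) v) _) (allRows r c))
                                 (sumBy-*ˡ (𝟙 (unitIn (prefix b) v)) _ (allRows r c)))
                    (allVecs c))

placement⇒binary : (bs : Vec ℕ r) (C : Vec ℕ c) (M : Vec (Vec Bool c) r) → T (placement bs C M) → Binary C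
placement⇒binary []       C []      p = allOnes⇒binary C p
placement⇒binary (b ∷ bs) C (v ∷ M) p =
  binary-addRow⁻ C v (placement⇒binary bs (addRow C v) M (proj₂ (to T-∧ p)))

#placements-nonbinary : (bs : Vec ℕ r) (C : Vec ℕ c) → ¬ Binary C → #placements bs C ≡ 0
#placements-nonbinary {r} {c} bs C ¬bin = sumBy-zero none (allRows r c)
  where
  none : ∀ M → 𝟙 (placement bs C M) ≡ 0
  none M with placement bs C M in p
  ... | false = refl
  ... | true  = ⊥-elim (¬bin (placement⇒binary bs C M (from T-≡ p)))

-- The columns used so far (those counted in C) lie inside every remaining bound, so the next row,
-- with bound b, has b ∸ sum C free columns.
#placements≡freeChoices : (bs : Vec ℕ r) (C : Vec ℕ c) → Binary C → Vec.sum C + r ≡ c → Monotone bs →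
  (∀ i → lookup bs i ≤ c) → (∀ i → VanishesFrom (lookup bs i) C) →
  #placements bs C ≡ freeChoices bs (Vec.sum C)
#placements≡freeChoices []       C bin full _ _ _ =
  cong (λ a → 𝟙 a + 0) (to T-≡ (binary-full⇒allOnes C bin (trans (sym (+-identityʳ _)) full)))
#placements≡freeChoices {suc r} {c} (b ∷ bs) C bin full mono bound van = begin
  #placements (b ∷ bs) C
    ≡⟨ #placements-∷ b bs C ⟩
  sumBy (λ v → 𝟙 (unitIn (prefix b) v) * #placements bs (addRow C v)) (allVecs c)
    ≡⟨ sumBy-cong byRow (allVecs c) ⟩
  sumBy (λ v → K * 𝟙 (unitIn (prefix b ∩ vacant C) v)) (allVecs c)
    ≡⟨ sumBy-*ˡ K _ (allVecs c) ⟩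
  K * sumBy (𝟙 ∘ unitIn (prefix b ∩ vacant C)) (allVecs c)
    ≡⟨ cong (K *_) (#unitIn (prefix b ∩ vacant C)) ⟩
  K * countTrue (prefix b ∩ vacant C)
    ≡⟨ cong (K *_) (countTrue-prefix∩vacant b C (van fzero) bin (bound fzero)) ⟩
  K * (b ∸ Vec.sum C)
    ≡⟨ *-comm K _ ⟩
  freeChoices (b ∷ bs) (Vec.sum C) ∎
  where
  open ≡-Reasoning
  K = freeChoices bs (suc (Vec.sum C))
  rest : ∀ v → T (unitIn (prefix b) v) → T (unitIn (prefix b ∩ vacant C) v) →
         #placements bs (addRow C v) ≡ K
  rest v u w = trans
    (#placements≡freeChoices bs (addRow C v) (from (binary-addRow⇔ (prefix b) C v bin u) w)
      (trans (cong (_+ r) (sum-addRow-unitIn (prefix b) C v u)) (trans (sym (+-suc _ r)) full))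
      (λ i j i≤j → mono (fsuc i) (fsuc j) (s≤s i≤j))
      (bound ∘ fsuc)
      (λ i → vanishesFrom-mono (addRow C v) (mono fzero (fsuc i) z≤n)
                               (vanishesFrom-addRow b C v (van fzero) u)))
    (cong (freeChoices bs) (sum-addRow-unitIn (prefix b) C v u))
  byRow : ∀ v → 𝟙 (unitIn (prefix b) v) * #placements bs (addRow C v)
                  ≡ K * 𝟙 (unitIn (prefix b ∩ vacant C) v)
  byRow v with unitIn (prefix b) v in u | unitIn (prefix b ∩ vacant C) v in w
  ... | false | false = sym (*-zeroʳ K)
  ... | false | true  = ⊥-elim (subst T u (unitIn-∩ˡ (prefix b) (vacant C) v (from T-≡ w)))
  ... | true  | false = trans (+-identityʳ _) (trans
        (#placements-nonbinary bs (addRow C v)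
          (λ bin′ → subst T w (to (binary-addRow⇔ (prefix b) C v bin (from T-≡ u)) bin′)))
        (sym (*-zeroʳ K)))
  ... | true  | true  = trans (+-identityʳ _) (trans (rest v (from T-≡ u) (from T-≡ w)) (sym (*-identityʳ K)))

-- RP(μ) as a set of rook placements

col : Vec (Vec Bool c) r → Fin c → Vec Bool r
col M j = Vec.map (λ row → lookup row j) M

allOnes⇔ : (C : Vec ℕ c) → T (allOnes C) ⇔ (∀ j → lookup C j ≡ 1)
allOnes⇔ []      = mk⇔ (λ _ ()) (λ _ → tt)
allOnes⇔ (x ∷ C) = mk⇔
  (λ ones → let (x≡1 , rest) = to T-∧ ones in
    λ { fzero → ≡ᵇ⇒≡ x 1 x≡1 ; (fsuc j) → to (allOnes⇔ C) rest j })
  (λ ones → from T-∧ (≡⇒≡ᵇ x 1 (ones fzero) , from (allOnes⇔ C) (ones ∘ fsuc)))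

placement⇔ : (bs : Vec ℕ r) (C : Vec ℕ c) (M : Vec (Vec Bool c) r) →
  T (placement bs C M) ⇔
  ((∀ i → T (unitIn (prefix (lookup bs i)) (lookup M i))) × (∀ j → lookup C j + countTrue (col M j) ≡ 1))
placement⇔ []       C []      = mk⇔
  (λ ones → (λ ()) , λ j → trans (+-identityʳ _) (to (allOnes⇔ C) ones j))
  (λ (_ , cols) → from (allOnes⇔ C) (λ j → trans (sym (+-identityʳ _)) (cols j)))
placement⇔ (b ∷ bs) C (v ∷ M) = mk⇔
  (λ p → let (u , p′) = to T-∧ p; (rows , cols) = to (placement⇔ bs (addRow C v) M) p′ in
    (λ { fzero → u ; (fsuc i) → rows i }) , λ j → trans (colCount j) (cols j))
  (λ (rows , cols) → from T-∧ (rows fzero ,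
    from (placement⇔ bs (addRow C v) M) (rows ∘ fsuc , λ j → trans (sym (colCount j)) (cols j))))
  where
  colCount : ∀ j → lookup C j + countTrue (col (v ∷ M) j) ≡ lookup (addRow C v) j + countTrue (col M j)
  colCount j = begin
    lookup C j + countTrue (lookup v j ∷ col M j)      ≡⟨ cong (lookup C j +_) (countTrue-∷ (lookup v j) (col M j)) ⟩
    lookup C j + (𝟙 (lookup v j) + countTrue (col M j)) ≡⟨ +-assoc (lookup C j) _ _ ⟨
    lookup C j + 𝟙 (lookup v j) + countTrue (col M j)   ≡⟨ cong (_+ countTrue (col M j)) (+-comm (lookup C j) _) ⟩
    𝟙 (lookup v j) + lookup C j + countTrue (col M j)   ≡⟨ cong (_+ countTrue (col M j)) (lookup-zipWith _ j C v) ⟨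
    lookup (addRow C v) j + countTrue (col M j)         ∎
    where open ≡-Reasoning

-- Row r (from the top, 0-indexed) of a matrix in RP(μ) may use the first μ_{N−r} columns.
rowBounds : (μ : List ℕ) → Vec ℕ (length μ)
rowBounds []      = []
rowBounds (x ∷ μ) = rowBounds μ ∷ʳ x

lookup-∷ʳ-tabulates : ∀ {n} (v : Vec ℕ n) x (f : ℕ → ℕ) → (∀ i → lookup v i ≡ f (toℕ i)) → f n ≡ x →
                      ∀ i → lookup (v ∷ʳ x) i ≡ f (toℕ i)
lookup-∷ʳ-tabulates []      x f _ fn≡x fzero    = sym fn≡x
lookup-∷ʳ-tabulates (y ∷ v) x f v≗f _ fzero    = v≗f fzero
lookup-∷ʳ-tabulates (y ∷ v) x f v≗f fn≡x (fsuc i) =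
  lookup-∷ʳ-tabulates v x (f ∘ suc) (v≗f ∘ fsuc) fn≡x i

part-∷ : ∀ x xs {L} t → t < L → part (x ∷ xs) (suc L ∸ t) ≡ part xs (L ∸ t)
part-∷ x xs {suc L} zero    _         = refl
part-∷ x xs {suc L} (suc t) (s≤s t<L) = part-∷ x xs t t<L

lookup-rowBounds : ∀ μ (i : Fin (length μ)) → lookup (rowBounds μ) i ≡ part μ (length μ ∸ toℕ i)
lookup-rowBounds (x ∷ μ) =
  lookup-∷ʳ-tabulates (rowBounds μ) x (λ t → part (x ∷ μ) (suc (length μ) ∸ t))
  (λ i → trans (lookup-rowBounds μ i) (sym (part-∷ x μ (toℕ i) (toℕ<n i))))
  (cong (part (x ∷ μ)) (trans (+-∸-assoc 1 (≤-refl {length μ})) (cong suc (n∸n≡0 (length μ)))))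

unitIn-prefix⇔ : ∀ b (v : Vec Bool c) →
                 T (unitIn (prefix b) v) ⇔ (countTrue v ≡ 1 × (∀ i → T (lookup v i) → toℕ i < b))
unitIn-prefix⇔ b v = mk⇔
  (λ u → let (one , inPrefix) = to (unitIn⇔ (prefix b) v) u in one , λ i → to (prefix⇔ b i) ∘ inPrefix i)
  (λ (one , below) → from (unitIn⇔ (prefix b) v) (one , λ i → from (prefix⇔ b i) ∘ below i))

RP⇔placement : ∀ μ (M : Matrix (length μ)) →
               T (isPermMatrix M ∧ fitsRP μ M) ⇔ T (placement (rowBounds μ) (replicate (length μ) 0) M)
RP⇔placement μ M = mk⇔
  (λ rp → let (perm , fits) = to T-∧ rp; (rows , cols) = to T-∧ perm in
    from (placement⇔ (rowBounds μ) (replicate N 0) M)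
      ( (λ i → to (rowFits⇔unitIn i)
                 (to (all-allFin⇔ rowOne) rows i , to (all-allFin⇔ (fit i)) (to (all-allFin⇔ rowFits) fits i)))
      , λ j → to (colOne⇔ j) (to (all-allFin⇔ colOne) cols j)))
  (λ pl → let (units , cols) = to (placement⇔ (rowBounds μ) (replicate N 0) M) pl in
    from T-∧
      ( from T-∧ ( from (all-allFin⇔ rowOne) (proj₁ ∘ from (rowFits⇔unitIn _) ∘ units)
                 , from (all-allFin⇔ colOne) (from (colOne⇔ _) ∘ cols))
      , from (all-allFin⇔ rowFits)
               (λ i → from (all-allFin⇔ (fit i)) (proj₂ (from (rowFits⇔unitIn i) (units i))))))
  where
  N = length μ
  rowOne colOne : Fin N → Bool
  rowOne i = countTrue (lookup M i) ≡ᵇ 1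
  colOne j = countTrue (column M j) ≡ᵇ 1
  fit : Fin N → Fin N → Bool
  fit r c = not (entry M r c) ∨ (toℕ c <ᵇ part μ (N ∸ toℕ r))
  rowFits : Fin N → Bool
  rowFits r = all (fit r) (allFin N)

  rowFits⇔unitIn : ∀ i → (T (rowOne i) × (∀ c → T (fit i c)))
                         ⇔ T (unitIn (prefix (lookup (rowBounds μ) i)) (lookup M i))
  rowFits⇔unitIn i rewrite lookup-rowBounds μ i = mk⇔
    (λ (one , fits) → from (unitIn-prefix⇔ b (lookup M i))
       (≡ᵇ⇒≡ _ 1 one , λ c t → <ᵇ⇒< (toℕ c) b (to (not∨⇔ (entry M i c) _) (fits c) t)))
    (λ u → let (one , below) = to (unitIn-prefix⇔ b (lookup M i)) u in
       ≡⇒≡ᵇ _ 1 one , λ c → from (not∨⇔ (entry M i c) _) (<⇒<ᵇ ∘ below c))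
    where b = part μ (N ∸ toℕ i)

  colOne⇔ : ∀ j → T (colOne j) ⇔ (lookup (replicate N 0) j + countTrue (col M j) ≡ 1)
  colOne⇔ j rewrite lookup-replicate j 0 = mk⇔ (≡ᵇ⇒≡ _ 1) (≡⇒≡ᵇ _ 1)

part≤head : ∀ x xs → Linked _≥_ (x ∷ xs) → ∀ k → part (x ∷ xs) k ≤ x
part≤head x xs       dec       zero          = z≤n
part≤head x xs       dec       (suc zero)    = ≤-refl
part≤head x []       dec       (suc (suc k)) = z≤n
part≤head x (y ∷ xs) (y≤x ∷ dec) (suc (suc k)) = ≤-trans (part≤head y xs dec (suc k)) y≤x

part-antitone : ∀ xs → Linked _≥_ xs → ∀ {a b} → 1 ≤ a → a ≤ b → part xs b ≤ part xs a
part-antitone []       dec {b = b}     _ _ = z≤n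
part-antitone (x ∷ xs) dec {suc zero} {b} _ _ = part≤head x xs dec b
part-antitone (x ∷ xs) dec {suc (suc a)} {suc (suc b)} _ (s≤s a≤b) =
  part-antitone xs (Linked.tail dec) (s≤s z≤n) a≤b

#RP≡freeChoices : ∀ μ → Linked _≥_ μ → (∀ k → part μ k ≤ length μ) → #RP μ ≡ freeChoices (rowBounds μ) 0
#RP≡freeChoices μ dec bounded = begin
  #RP μ
    ≡⟨ length-filterᵇ _ (allMatrices N) ⟩
  sumBy (λ M → 𝟙 (isPermMatrix M ∧ fitsRP μ M)) (allMatrices N)
    ≡⟨ sumBy-cong (λ M → cong 𝟙 (T-injective (RP⇔placement μ M))) (allMatrices N) ⟩
  #placements (rowBounds μ) (replicate N 0)
    ≡⟨ #placements≡freeChoices (rowBounds μ) (replicate N 0) (binary-zeros N) (cong (_+ N) (sum-zeros N))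
         monotone (λ i → subst (_≤ N) (sym (lookup-rowBounds μ i)) (bounded (N ∸ toℕ i)))
         (λ i → sum≡0⇒vanishesFrom (lookup (rowBounds μ) i) (replicate N 0) (sum-zeros N)) ⟩
  freeChoices (rowBounds μ) (Vec.sum (replicate N 0))
    ≡⟨ cong (freeChoices (rowBounds μ)) (sum-zeros N) ⟩
  freeChoices (rowBounds μ) 0 ∎
  where
  open ≡-Reasoning
  N = length μ
  binary-zeros : ∀ n → Binary (replicate n 0)
  binary-zeros zero    = []
  binary-zeros (suc n) = z≤n ∷ binary-zeros n
  sum-zeros : ∀ n → Vec.sum (replicate n 0) ≡ 0
  sum-zeros zero    = refl
  sum-zeros (suc n) = sum-zeros n
  monotone : Monotone (rowBounds μ)
  monotone i j i≤j rewrite lookup-rowBounds μ i | lookup-rowBounds μ j =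
    part-antitone μ dec (m<n⇒0<n∸m (toℕ<n j)) (∸-monoʳ-≤ N i≤j)

-- The product for m ⊙ λ

-- prodParts F λ = ∏ᵢ F λᵢ (n − i); the second argument counts the parts after λᵢ.
prodParts : (ℕ → ℕ → ℕ) → List ℕ → ℕ
prodParts F []       = 1
prodParts F (x ∷ xs) = F x (length xs) * prodParts F xs

freeChoices-∷ʳ : ∀ {n} (v : Vec ℕ n) x s → freeChoices (v ∷ʳ x) s ≡ freeChoices v s * (x ∸ (s + n))
freeChoices-∷ʳ []      x s =
  trans (*-identityʳ _) (trans (cong (x ∸_) (sym (+-identityʳ s))) (sym (*-identityˡ _)))
freeChoices-∷ʳ {suc n} (y ∷ v) x s rewrite freeChoices-∷ʳ v x (suc s) | +-suc s n =
  sym (*-assoc (y ∸ s) _ _)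

freeChoices-rowBounds : ∀ μ s → freeChoices (rowBounds μ) s ≡ prodParts (λ x d → x ∸ (s + d)) μ
freeChoices-rowBounds []      s = refl
freeChoices-rowBounds (x ∷ μ) s rewrite freeChoices-∷ʳ (rowBounds μ) x s | freeChoices-rowBounds μ s =
  *-comm (prodParts _ μ) _

prodParts-++ : ∀ F ys zs →
               prodParts F (ys ++ zs) ≡ prodParts (λ x d → F x (length zs + d)) ys * prodParts F zs
prodParts-++ F []       zs = sym (+-identityʳ _)
prodParts-++ F (y ∷ ys) zs
  rewrite prodParts-++ F ys zs | List.length-++ ys {zs} | +-comm (length ys) (length zs) =
  sym (*-assoc (F y (length zs + length ys)) _ _)

prodParts-replicate : ∀ L k z → prodParts (λ x d → x ∸ (L + d)) (List.replicate k z) ≡ (z ∸ L) P′ k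
prodParts-replicate L zero    z = refl
prodParts-replicate L (suc k) z
  rewrite prodParts-replicate L k z | List.length-replicate k {z} | ∸-+-assoc z L k = refl

length-⊙ : ∀ m xs → length (m ⊙ xs) ≡ m * length xs
length-⊙ m []       = sym (*-zeroʳ m)
length-⊙ m (x ∷ xs) = begin
  length (List.replicate m (m * x) ++ m ⊙ xs)        ≡⟨ List.length-++ (List.replicate m (m * x)) ⟩
  length (List.replicate m (m * x)) + length (m ⊙ xs) ≡⟨ cong₂ _+_ (List.length-replicate m) (length-⊙ m xs) ⟩
  m + m * length xs                                   ≡⟨ *-suc m (length xs) ⟨
  m * suc (length xs)                                 ∎
  where open ≡-Reasoning

prodParts-⊙ : ∀ m xs → prodParts (λ x d → x ∸ d) (m ⊙ xs) ≡ prodParts (λ x d → (m * (x ∸ d)) P′ m) xs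
prodParts-⊙ m []       = refl
prodParts-⊙ m (x ∷ xs) = begin
  prodParts (λ y d → y ∸ d) (List.replicate m (m * x) ++ m ⊙ xs)
    ≡⟨ prodParts-++ (λ y d → y ∸ d) (List.replicate m (m * x)) (m ⊙ xs) ⟩
  prodParts (λ y d → y ∸ (L + d)) (List.replicate m (m * x)) * prodParts (λ y d → y ∸ d) (m ⊙ xs)
    ≡⟨ cong₂ _*_ (prodParts-replicate L m (m * x)) (prodParts-⊙ m xs) ⟩
  ((m * x ∸ L) P′ m) * prodParts (λ y d → (m * (y ∸ d)) P′ m) xs
    ≡⟨ cong (λ y → (y P′ m) * prodParts (λ y d → (m * (y ∸ d)) P′ m) xs)
            (trans (cong (m * x ∸_) (length-⊙ m xs)) (sym (*-distribˡ-∸ m x (length xs)))) ⟩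
  ((m * (x ∸ length xs)) P′ m) * prodParts (λ y d → (m * (y ∸ d)) P′ m) xs ∎
  where
  open ≡-Reasoning
  L = length (m ⊙ xs)

-- Generalised binomial coefficients

-- Opened only here: ℤ's +_ would make the sections (x +_) on ℕ above ambiguous.
open import Data.Integer as ℤ using (ℤ; +_)
import Data.Integer.Properties as ℤ
import Data.Integer.Tactic.RingSolver as ℤSolver

prodPartsℤ : (ℕ → ℕ → ℤ) → List ℕ → ℤ
prodPartsℤ G []       = + 1
prodPartsℤ G (x ∷ xs) = G x (length xs) ℤ.* prodPartsℤ G xs

pos-prodParts : ∀ F xs → + prodParts F xs ≡ prodPartsℤ (λ x d → + F x d) xs
pos-prodParts F []       = refl
pos-prodParts F (x ∷ xs) =
  trans (ℤ.pos-* (F x (length xs)) _) (cong (+ F x (length xs) ℤ.*_) (pos-prodParts F xs))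

prodℤ-∷ : ∀ k f → prodℤ (suc k) f ≡ f 1 ℤ.* prodℤ k (f ∘ suc)
prodℤ-∷ zero    f = trans (ℤ.*-identityˡ (f 1)) (sym (ℤ.*-identityʳ (f 1)))
prodℤ-∷ (suc k) f rewrite prodℤ-∷ k f = ℤ.*-assoc (f 1) (prodℤ k (f ∘ suc)) (f (suc (suc k)))

-- prodℤ never evaluates its factor at 0.
prodℤ-cong : ∀ k {f g : ℕ → ℤ} → (∀ j → f (suc j) ≡ g (suc j)) → prodℤ k f ≡ prodℤ k g
prodℤ-cong zero    f≗g = refl
prodℤ-cong (suc k) f≗g = cong₂ ℤ._*_ (prodℤ-cong k f≗g) (f≗g k)

prodℤ≡prodPartsℤ : ∀ G ls → prodℤ (length ls) (λ i → G (part ls i) (length ls ∸ i)) ≡ prodPartsℤ G ls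
prodℤ≡prodPartsℤ G []       = refl
prodℤ≡prodPartsℤ G (x ∷ xs) = trans (prodℤ-∷ (length xs) _)
  (cong (G x (length xs) ℤ.*_) (trans (prodℤ-cong (length xs) (λ j → refl)) (prodℤ≡prodPartsℤ G xs)))

AboveStaircase : List ℕ → Set
AboveStaircase []       = ⊤
AboveStaircase (x ∷ xs) = length xs ≤ x × AboveStaircase xs

MeetsStaircase : List ℕ → Set
MeetsStaircase []       = ⊥
MeetsStaircase (x ∷ xs) = x ≡ length xs ⊎ MeetsStaircase xs

-- Along a weakly decreasing sequence λᵢ − (n − i) drops by at most one per step and ends at
-- λₙ ≥ 0, so it cannot turn negative without passing through 0.
staircase-dichotomy : ∀ xs → Linked _≥_ xs → AboveStaircase xs ⊎ MeetsStaircase xs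
staircase-dichotomy []       _   = inj₁ tt
staircase-dichotomy (x ∷ xs) dec with staircase-dichotomy xs (Linked.tail dec)
... | inj₂ meets = inj₂ (inj₂ meets)
... | inj₁ above with length xs ≤? x
...   | yes below = inj₁ (below , above)
staircase-dichotomy (x ∷ [])     _           | inj₁ _          | no x<0   = ⊥-elim (x<0 z≤n)
staircase-dichotomy (x ∷ y ∷ ys) (y≤x ∷ dec) | inj₁ (ys≤y , _) | no x<len =
  inj₂ (inj₂ (inj₁ (≤-antisym (≤-pred (≤-trans (s≤s y≤x) (≰⇒> x<len))) ys≤y)))

prodPartsℤ-above : ∀ {F G : ℕ → ℕ → ℤ} k → (∀ x d → d ≤ x → F x d ≡ k ℤ.* G x d) →
                   ∀ xs → AboveStaircase xs → prodPartsℤ F xs ≡ k ℤ.^ length xs ℤ.* prodPartsℤ G xs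
prodPartsℤ-above k F≡kG []       _               = refl
prodPartsℤ-above {F} {G} k F≡kG (x ∷ xs) (below , above) = begin
  F x (length xs) ℤ.* prodPartsℤ F xs
    ≡⟨ cong₂ ℤ._*_ (F≡kG x (length xs) below) (prodPartsℤ-above k F≡kG xs above) ⟩
  k ℤ.* G x (length xs) ℤ.* (k ℤ.^ length xs ℤ.* prodPartsℤ G xs)
    ≡⟨ interchange k (G x (length xs)) (k ℤ.^ length xs) (prodPartsℤ G xs) ⟩
  k ℤ.* k ℤ.^ length xs ℤ.* (G x (length xs) ℤ.* prodPartsℤ G xs) ∎
  where
  open ≡-Reasoning
  interchange : ∀ a b c d → a ℤ.* b ℤ.* (c ℤ.* d) ≡ a ℤ.* c ℤ.* (b ℤ.* d)
  interchange = ℤSolver.solve-∀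

prodPartsℤ-meets : ∀ {F : ℕ → ℕ → ℤ} → (∀ d → F d d ≡ + 0) →
                   ∀ xs → MeetsStaircase xs → prodPartsℤ F xs ≡ + 0
prodPartsℤ-meets Fdd≡0 (x ∷ xs) (inj₁ refl) rewrite Fdd≡0 (length xs) = refl
prodPartsℤ-meets {F} Fdd≡0 (x ∷ xs) (inj₂ meets) =
  trans (cong (F x (length xs) ℤ.*_) (prodPartsℤ-meets Fdd≡0 xs meets)) (ℤ.*-zeroʳ (F x (length xs)))

fallingℤ-pos : ∀ y k → fallingℤ (+ y) k ≡ + (y P′ k)
fallingℤ-pos y       zero    = refl
fallingℤ-pos zero    (suc k) rewrite 0∸n≡0 k = refl
fallingℤ-pos (suc y) (suc k) = begin
  + suc y ℤ.* fallingℤ (+ suc y ℤ.- + 1) k ≡⟨ cong (λ a → + suc y ℤ.* fallingℤ a k) (ℤ.m-n≡m⊖n (suc y) 1) ⟩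
  + suc y ℤ.* fallingℤ (+ y) k             ≡⟨ cong (+ suc y ℤ.*_) (fallingℤ-pos y k) ⟩
  + suc y ℤ.* + (y P′ k)                   ≡⟨ ℤ.pos-* (suc y) (y P′ k) ⟨
  + (suc y * (y P′ k))                     ≡⟨ cong +_ (nP′k≡n[n∸1P′k∸1] (suc y) (suc k)) ⟨
  + (suc y P′ suc k)                       ∎
  where open ≡-Reasoning

m!∣P′ : ∀ y m → m ! ∣ y P′ m
m!∣P′ y m with m ≤? y
... | yes m≤y = k!∣nP′k m≤y
... | no  m>y = subst (m ! ∣_) (sym (P′-vanishes (≰⇒> m>y))) ((m !) ∣0)
  where
  P′-vanishes : ∀ {y k} → y < k → y P′ k ≡ 0
  P′-vanishes {y} {suc k} (s≤s y≤k) with m≤n⇒m<n∨m≡n y≤k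
  ... | inj₁ y<k  = trans (cong ((y ∸ k) *_) (P′-vanishes y<k)) (*-zeroʳ (y ∸ k))
  ... | inj₂ refl = cong (_* (y P′ y)) (n∸n≡0 y)

m!*binomℤ : ∀ y m → + (m !) ℤ.* binomℤ (+ y) m ≡ + (y P′ m)
m!*binomℤ y m rewrite fallingℤ-pos y m =
  trans (sym (ℤ.pos-* (m !) (_/_ (y P′ m) (m !) {{m !≢0}}))) (cong +_ (m*[n/m]≡n {{m !≢0}} (m!∣P′ y m)))

binomℤ-zero : ∀ m → binomℤ (+ 0) (suc m) ≡ + 0
binomℤ-zero m = cong +_ (0/n≡0 (suc m !) {{suc m !≢0}})

P′≡m!*binomℤ : ∀ m x d → d ≤ x →
               + ((m * (x ∸ d)) P′ m) ≡ + (m !) ℤ.* binomℤ (+ (m * x) ℤ.- + (m * d)) m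
P′≡m!*binomℤ m x d d≤x
  rewrite ℤ.m-n≡m⊖n (m * x) (m * d) | ℤ.⊖-≥ (*-monoʳ-≤ m d≤x) | sym (*-distribˡ-∸ m x d) =
  sym (m!*binomℤ (m * (x ∸ d)) m)

prodParts-P′≡binomℤ : ∀ m xs → Linked _≥_ xs →
  + prodParts (λ x d → (suc m * (x ∸ d)) P′ suc m) xs
    ≡ (+ (suc m !)) ℤ.^ length xs
        ℤ.* prodPartsℤ (λ x d → binomℤ (+ (suc m * x) ℤ.- + (suc m * d)) (suc m)) xs
prodParts-P′≡binomℤ m xs dec
  rewrite pos-prodParts (λ x d → (suc m * (x ∸ d)) P′ suc m) xs with staircase-dichotomy xs dec
... | inj₁ above = prodPartsℤ-above (+ (suc m !)) (P′≡m!*binomℤ (suc m)) xs above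
... | inj₂ meets = begin
  prodPartsℤ (λ x d → + ((suc m * (x ∸ d)) P′ suc m)) xs
    ≡⟨ prodPartsℤ-meets (λ d → cong +_ (P′-diagonal d)) xs meets ⟩
  + 0
    ≡⟨ ℤ.*-zeroʳ ((+ (suc m !)) ℤ.^ length xs) ⟨
  (+ (suc m !)) ℤ.^ length xs ℤ.* + 0
    ≡⟨ cong ((+ (suc m !)) ℤ.^ length xs ℤ.*_) (prodPartsℤ-meets binomℤ-diagonal xs meets) ⟨
  (+ (suc m !)) ℤ.^ length xs ℤ.* prodPartsℤ (λ x d → binomℤ (+ (suc m * x) ℤ.- + (suc m * d)) (suc m)) xs ∎
  where
  open ≡-Reasoning
  P′-diagonal : ∀ d → (suc m * (d ∸ d)) P′ suc m ≡ 0
  P′-diagonal d rewrite n∸n≡0 d | *-zeroʳ m | 0∸n≡0 m = refl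
  binomℤ-diagonal : ∀ d → binomℤ (+ (suc m * d) ℤ.- + (suc m * d)) (suc m) ≡ + 0
  binomℤ-diagonal d = trans (cong (λ a → binomℤ a (suc m)) (ℤ.+-inverseʳ (+ (suc m * d)))) (binomℤ-zero m)

All-⊙ : ∀ m ls → 1 ≤ m → ListAll.All (1 ≤_) ls → ListAll.All (1 ≤_) (m ⊙ ls)
All-⊙ m ls 1≤m pos =
  ListAll.concat⁺ (ListAll.map⁺ (ListAll.map (λ 1≤x → ListAll.replicate⁺ m (*-mono-≤ 1≤m 1≤x)) pos))

Linked-replicate-∷ : ∀ k {a ys} → Linked _≥_ (a ∷ ys) → Linked _≥_ (a ∷ List.replicate k a ++ ys)
Linked-replicate-∷ zero    dec = dec
Linked-replicate-∷ (suc k) dec = ≤-refl ∷ Linked-replicate-∷ k dec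

Linked-⊙-∷ : ∀ m x xs → Linked _≥_ (x ∷ xs) → Linked _≥_ (suc m * x ∷ suc m ⊙ xs)
Linked-⊙-∷ m x []       _           = [-]
Linked-⊙-∷ m x (y ∷ ys) (y≤x ∷ dec) =
  *-monoʳ-≤ (suc m) y≤x ∷ Linked-replicate-∷ m (Linked-⊙-∷ m y ys dec)

Linked-⊙ : ∀ m xs → Linked _≥_ xs → Linked _≥_ (suc m ⊙ xs)
Linked-⊙ m []       _   = []
Linked-⊙ m (x ∷ xs) dec = Linked-replicate-∷ m (Linked-⊙-∷ m x xs dec)

proposition2p1 : (m n : ℕ) (ls : List ℕ) → 1 ≤ m → 1 ≤ n →
    IsPartition ls → length ls ≡ n → head ls ≡ just n →
    IsPartition (m ⊙ ls) × length (m ⊙ ls) ≡ m * n × head (m ⊙ ls) ≡ just (m * n) ×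
    (+ #RP (m ⊙ ls) ≡
      (+ (m !)) ℤ.^ n ℤ.* prodℤ n (λ i → binomℤ (+ (m * part ls i) ℤ.- + (m * (n ∸ i))) m))
proposition2p1 (suc m) _ ls@(x ∷ xs) 1≤m _ (pos , dec) refl hd with just-injective hd
... | refl = (All-⊙ (suc m) ls 1≤m pos , dec-μ) , length-⊙ (suc m) ls , refl , count
  where
  μ = suc m ⊙ ls
  n = length ls
  dec-μ : Linked _≥_ μ
  dec-μ = Linked-⊙ m ls dec
  G : ℕ → ℕ → ℤ
  G y d = binomℤ (+ (suc m * y) ℤ.- + (suc m * d)) (suc m)
  bounded : ∀ k → part μ k ≤ length μ
  bounded k = subst (part μ k ≤_) (sym (length-⊙ (suc m) ls)) (part≤head _ _ dec-μ k)
  count : + #RP μ ≡ (+ (suc m !)) ℤ.^ n ℤ.* prodℤ n (λ i → G (part ls i) (n ∸ i))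
  count = begin
    + #RP μ                                      ≡⟨ cong +_ (#RP≡freeChoices μ dec-μ bounded) ⟩
    + freeChoices (rowBounds μ) 0                ≡⟨ cong +_ (freeChoices-rowBounds μ 0) ⟩
    + prodParts (λ y d → y ∸ d) μ                ≡⟨ cong +_ (prodParts-⊙ (suc m) ls) ⟩
    + prodParts (λ y d → (suc m * (y ∸ d)) P′ suc m) ls
                                                 ≡⟨ prodParts-P′≡binomℤ m ls dec ⟩
    (+ (suc m !)) ℤ.^ n ℤ.* prodPartsℤ G ls      ≡⟨ cong ((+ (suc m !)) ℤ.^ n ℤ.*_) (prodℤ≡prodPartsℤ G ls) ⟨
    (+ (suc m !)) ℤ.^ n ℤ.* prodℤ n (λ i → G (part ls i) (n ∸ i)) ∎
    where open ≡-Reasoning
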